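{- Let $f\colon X\to Y$ be a morphism in $\mathbf{SupOMLatLin}$. Then the image $\mathrm{Im}(f)=\ker(\mathrm{coker}(f))$ is $\downarrow f(1)$, represented by the inclusion $i_f\colon\downarrow f(1)\to Y$; the morphism $e_f=(i_f)^{*}\circ f\colon X\to\downarrow f(1)$ is the corestriction $x\mapsto f(x)$; and $m_f=e_f\circ i_{f^{*}}\colon\downarrow f^{*}(1)\to\downarrow f(1)$ is the restriction–corestriction $u\mapsto f(u)$. Consequently $f=i_f\circ e_f$ with $e_f$ zero-epi and $i_f$ a dagger kernel, and $f=i_f\circ m_f\circ(i_{f^{*}})^{*}$, where $(i_{f^*})^*\colon X\to\downarrow f^*(1)$ is dagger epi, $m_f$ is zero-epi and zero-mono, and $i_f$ is dagger mono.
   Context: An orthomodular lattice is a lattice with $0,1$ and an involutive, order-reversing orthocomplement $x\mapsto x^\perp$ with $x\wedge x^\perp=0$, satisfying $x\le y\Rightarrow y=x\vee(x^\perp\wedge y)$; complete means all joins exist. $x\perp y$ means $x\le y^\perp$. $\mathbf{SupOMLatLin}$ has complete orthomodular lattices as objects and linear maps as morphisms ($f\colon X\to Y$ with a unique $f^{*}\colon Y\to X$ such that $f(x)\perp y$ iff $x\perp f^{*}(y)$), dagger $f\mapsto f^*$, zero object $\{0\}$. It is a dagger kernel category: the dagger kernel of $g\colon A\to B$ is the inclusion $\downarrow g^{*}(1)^{\perp}\to A$, whose adjoint is the Sasaki projection $\pi_a(x)=a\wedge(a^\perp\vee x)$ with $a=g^*(1)^\perp$. Here $\downarrow a=\{u\le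 a\}$ with orthocomplement $u\mapsto a\wedge u^{\perp}$. Cokernels are $\mathrm{coker}(g)=\ker(g^{*})^{*}$. The image of $f$ is $\ker(\mathrm{coker}(f))$, represented by a dagger mono $i_f\colon\mathrm{Im}(f)\to Y$. A morphism $f\colon A\to B$ is zero-epi if $g\circ f=0$ implies $g=0$ for all $g\colon B\to C$; zero-mono if $f^{*}$ is zero-epi; dagger mono if $f^*\circ f=1$; dagger epi if $f^*$ is dagger mono. -}

module Defs where

open import Level using (Level; _⊔_) renaming (suc to lsuc)
open import Data.Product using (Σ; _×_; _,_; proj₁; proj₂)
open import Function using (id; _∘_)

-- The order is given as a relation _≤_ (reflexive, transitive); equality
-- of elements is  x ≈ y = x ≤ y × y ≤ x  (i.e. the poset is the quotient
-- of this preorder; all constructions below respect ≈).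

record OML (ℓ : Level) : Set (lsuc ℓ) where
  infix  4 _≤_
  infixr 7 _∧_
  infixr 6 _∨_
  infix  8 _ᶜ
  field
    Carrier  : Set ℓ
    _≤_      : Carrier → Carrier → Set ℓ
    ≤-refl   : ∀ {x} → x ≤ x
    ≤-trans  : ∀ {x y z} → x ≤ y → y ≤ z → x ≤ z
    𝟘 𝟙      : Carrier
    𝟘-min    : ∀ {x} → 𝟘 ≤ x
    𝟙-max    : ∀ {x} → x ≤ 𝟙
    _∧_ _∨_  : Carrier → Carrier → Carrier
    ∧-lb₁    : ∀ {x y} → x ∧ y ≤ x
    ∧-lb₂    : ∀ {x y} → x ∧ y ≤ y
    ∧-glb    : ∀ {x y z} → z ≤ x → z ≤ y → z ≤ x ∧ y
    ∨-ub₁    : ∀ {x y} → x ≤ x ∨ y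
    ∨-ub₂    : ∀ {x y} → y ≤ x ∨ y
    ∨-lub    : ∀ {x y z} → x ≤ z → y ≤ z → x ∨ y ≤ z
    ⋁        : {I : Set ℓ} → (I → Carrier) → Carrier
    ⋁-ub     : ∀ {I : Set ℓ} (F : I → Carrier) (i : I) → F i ≤ ⋁ F
    ⋁-lub    : ∀ {I : Set ℓ} (F : I → Carrier) {z} → (∀ i → F i ≤ z) → ⋁ F ≤ z
    _ᶜ       : Carrier → Carrier
    ᶜᶜ-≤     : ∀ {x} → x ᶜ ᶜ ≤ x
    ≤-ᶜᶜ     : ∀ {x} → x ≤ x ᶜ ᶜ
    ᶜ-anti   : ∀ {x y} → x ≤ y → y ᶜ ≤ x ᶜ
    ∧ᶜ-𝟘     : ∀ {x} → x ∧ x ᶜ ≤ 𝟘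
    orthomod : ∀ {x y} → x ≤ y → y ≤ x ∨ (x ᶜ ∧ y)

  infix 4 _≈_ _⊥_
  _≈_ : Carrier → Carrier → Set ℓ
  x ≈ y = (x ≤ y) × (y ≤ x)

  _⊥_ : Carrier → Carrier → Set ℓ
  x ⊥ y = x ≤ y ᶜ

module OMLProps {ℓ} (X : OML ℓ) where
  open OML X

  _∙_ : ∀ {x y z} → x ≤ y → y ≤ z → x ≤ z
  _∙_ = ≤-trans
  infixr 5 _∙_

  shift : ∀ {x y} → x ≤ y ᶜ → y ≤ x ᶜ
  shift p = ≤-ᶜᶜ ∙ ᶜ-anti p

  ∧-mono : ∀ {x y x' y'} → x ≤ x' → y ≤ y' → x ∧ y ≤ x' ∧ y'
  ∧-mono p q = ∧-glb (∧-lb₁ ∙ p) (∧-lb₂ ∙ q)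

  ∨-mono : ∀ {x y x' y'} → x ≤ x' → y ≤ y' → x ∨ y ≤ x' ∨ y'
  ∨-mono p q = ∨-lub (p ∙ ∨-ub₁) (q ∙ ∨-ub₂)

  dm₁ : ∀ {x y} → (x ∨ y) ᶜ ≤ x ᶜ ∧ y ᶜ
  dm₁ = ∧-glb (ᶜ-anti ∨-ub₁) (ᶜ-anti ∨-ub₂)

  dm₂ : ∀ {x y} → x ᶜ ∧ y ᶜ ≤ (x ∨ y) ᶜ
  dm₂ = shift (∨-lub (shift ∧-lb₁) (shift ∧-lb₂))

  dm₃ : ∀ {x y} → (x ∧ y) ᶜ ≤ x ᶜ ∨ y ᶜ
  dm₃ = ᶜ-anti (dm₁ ∙ ∧-mono ᶜᶜ-≤ ᶜᶜ-≤) ∙ ᶜᶜ-≤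

  omd : ∀ {x y} → x ≤ y → y ∧ (y ᶜ ∨ x) ≤ x
  omd p = ∧-mono ≤-ᶜᶜ (∨-lub (≤-ᶜᶜ ∙ ᶜ-anti ∧-lb₁) (≤-ᶜᶜ ∙ ᶜ-anti ∧-lb₂))
          ∙ dm₂ ∙ ᶜ-anti (orthomod (ᶜ-anti p)) ∙ ᶜᶜ-≤

Down : ∀ {ℓ} (X : OML ℓ) → OML.Carrier X → OML ℓ
Down X a = record
  { Carrier  = Σ Carrier (λ u → u ≤ a)
  ; _≤_      = λ u v → proj₁ u ≤ proj₁ v
  ; ≤-refl   = ≤-refl
  ; ≤-trans  = ≤-trans
  ; 𝟘        = 𝟘 , 𝟘-min
  ; 𝟙        = a , ≤-refl
  ; 𝟘-min    = 𝟘-min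
  ; 𝟙-max    = λ {u} → proj₂ u
  ; _∧_      = λ u v → proj₁ u ∧ proj₁ v , ∧-lb₁ ∙ proj₂ u
  ; _∨_      = λ u v → proj₁ u ∨ proj₁ v , ∨-lub (proj₂ u) (proj₂ v)
  ; ∧-lb₁    = ∧-lb₁
  ; ∧-lb₂    = ∧-lb₂
  ; ∧-glb    = ∧-glb
  ; ∨-ub₁    = ∨-ub₁
  ; ∨-ub₂    = ∨-ub₂
  ; ∨-lub    = ∨-lub
  ; ⋁        = λ F → ⋁ (proj₁ ∘ F) , ⋁-lub (proj₁ ∘ F) (λ i → proj₂ (F i))
  ; ⋁-ub     = λ F i → ⋁-ub (proj₁ ∘ F) i
  ; ⋁-lub    = λ F h → ⋁-lub (proj₁ ∘ F) h
  ; _ᶜ       = λ u → a ∧ proj₁ u ᶜ , ∧-lb₁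
  ; ᶜᶜ-≤     = λ {u} → ∧-mono ≤-refl (dm₃ ∙ ∨-mono ≤-refl ᶜᶜ-≤) ∙ omd (proj₂ u)
  ; ≤-ᶜᶜ     = λ {u} → ∧-glb (proj₂ u) (shift ∧-lb₂)
  ; ᶜ-anti   = λ p → ∧-mono ≤-refl (ᶜ-anti p)
  ; ∧ᶜ-𝟘     = ∧-mono ≤-refl ∧-lb₂ ∙ ∧ᶜ-𝟘
  ; orthomod = λ {u} {v} p → orthomod p ∙ ∨-mono ≤-refl (∧-glb (∧-glb (∧-lb₂ ∙ proj₂ v) ∧-lb₁) ∧-lb₂)
  }
  where open OML X
        open OMLProps X

-- Linear maps: f with an adjoint f* such that  f x ⊥ y  ⇔  x ⊥ f* y.
-- (The adjoint is unique up to ≈, since the orthocomplement determines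
-- the order; so storing one adjoint is the same as asking for one.)

record Lin {ℓ} (X Y : OML ℓ) : Set ℓ where
  private
    module X = OML X
    module Y = OML Y
  field
    fun     : X.Carrier → Y.Carrier
    adj     : Y.Carrier → X.Carrier
    adjoint : ∀ x y → (fun x Y.⊥ y → x X.⊥ adj y) × (x X.⊥ adj y → fun x Y.⊥ y)

open Lin public

module _ {ℓ : Level} where

  infix 4 _≃_
  _≃_ : {X Y : OML ℓ} → Lin X Y → Lin X Y → Set ℓ
  _≃_ {X} {Y} f g = ∀ x → OML._≈_ Y (fun f x) (fun g x)

  idL : (X : OML ℓ) → Lin X X
  idL X = record { fun = id ; adj = id ; adjoint = λ x y → id , id }

  infixr 9 _∘L_
  _∘L_ : {X Y Z : OML ℓ} → Lin Y Z → Lin X Y → Lin X Z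
  g ∘L f = record
    { fun = fun g ∘ fun f
    ; adj = adj f ∘ adj g
    ; adjoint = λ x z →
        (λ p → proj₁ (adjoint f x (adj g z)) (proj₁ (adjoint g (fun f x) z) p))
      , (λ p → proj₂ (adjoint g (fun f x) z) (proj₂ (adjoint f x (adj g z)) p))
    }

  infix 10 _†
  _† : {X Y : OML ℓ} → Lin X Y → Lin Y X
  _† {X} {Y} f = record
    { fun = adj f
    ; adj = fun f
    ; adjoint = λ y x →
        (λ p → OMLProps.shift Y (proj₂ (adjoint f x y) (OMLProps.shift X p)))
      , (λ p → OMLProps.shift X (proj₁ (adjoint f x y) (OMLProps.shift Y p)))
    }

  0L : (X Y : OML ℓ) → Lin X Y
  0L X Y = record
    { fun = λ _ → OML.𝟘 Y
    ; adj = λ _ → OML.𝟘 X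
    ; adjoint = λ x y → (λ _ → OMLProps.shift X (OML.𝟘-min X)) , (λ _ → OML.𝟘-min Y)
    }

  -- inclusion  ↓ a → X ; its adjoint is the Sasaki projection
  -- π_a(x) = a ∧ (aᶜ ∨ x)
  incl : (X : OML ℓ) (a : OML.Carrier X) → Lin (Down X a) X
  incl X a = record
    { fun = proj₁
    ; adj = λ y → a ∧ (a ᶜ ∨ y) , ∧-lb₁
    ; adjoint = λ u y →
        (λ p → ∧-glb (proj₂ u)
                 (shift (∧-lb₂ ∙ ∨-lub (ᶜ-anti (proj₂ u)) (shift p))))
      , (λ p → p ∙ ∧-mono ≤-refl (dm₃ ∙ ∨-mono ≤-refl (dm₁ ∙ ∧-mono ᶜᶜ-≤ ≤-refl))
                 ∙ omd ∧-lb₁ ∙ ∧-lb₂)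
    }
    where open OML X
          open OMLProps X

  ZeroEpi : {A B : OML ℓ} → Lin A B → Set (lsuc ℓ)
  ZeroEpi {A} {B} f = ∀ (C : OML ℓ) (g : Lin B C) → g ∘L f ≃ 0L A C → g ≃ 0L B C

  ZeroMono : {A B : OML ℓ} → Lin A B → Set (lsuc ℓ)
  ZeroMono f = ZeroEpi (f †)

  DaggerMono : {A B : OML ℓ} → Lin A B → Set ℓ
  DaggerMono {A} f = (f †) ∘L f ≃ idL A

  DaggerEpi : {A B : OML ℓ} → Lin A B → Set ℓ
  DaggerEpi f = DaggerMono (f †)

  Unitary : {A B : OML ℓ} → Lin A B → Set ℓ
  Unitary {A} {B} f = ((f †) ∘L f ≃ idL A) × (f ∘L (f †) ≃ idL B)

  IsKernelOf : {K B C : OML ℓ} → Lin K B → Lin B C → Set (lsuc ℓ)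
  IsKernelOf {K} {B} {C} k g =
    (g ∘L k ≃ 0L K C)
    × (∀ (W : OML ℓ) (h : Lin W B) → g ∘L h ≃ 0L W C →
         Σ (Lin W K) (λ h' → (k ∘L h' ≃ h) × (∀ h'' → k ∘L h'' ≃ h → h'' ≃ h')))

  IsDaggerKernel : {K B : OML ℓ} → Lin K B → Set (lsuc ℓ)
  IsDaggerKernel {K} {B} k =
    Σ (OML ℓ) (λ C → Σ (Lin B C) (λ g → IsKernelOf k g)) × DaggerMono k

  KerObj : {A B : OML ℓ} → Lin A B → OML ℓ
  KerObj {A} {B} g = Down A (OML._ᶜ A (adj g (OML.𝟙 B)))

  ker : {A B : OML ℓ} (g : Lin A B) → Lin (KerObj g) A
  ker {A} {B} g = incl A (OML._ᶜ A (adj g (OML.𝟙 B)))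

  CokerObj : {A B : OML ℓ} → Lin A B → OML ℓ
  CokerObj g = KerObj (g †)

  coker : {A B : OML ℓ} (g : Lin A B) → Lin B (CokerObj g)
  coker g = (ker (g †)) †

  ImObj : {A B : OML ℓ} → Lin A B → OML ℓ
  ImObj f = KerObj (coker f)

  imMor : {A B : OML ℓ} (f : Lin A B) → Lin (ImObj f) B
  imMor f = ker (coker f)

  iMap : {X Y : OML ℓ} (f : Lin X Y) → Lin (Down Y (fun f (OML.𝟙 X))) Y
  iMap {X} {Y} f = incl Y (fun f (OML.𝟙 X))

  eMap : {X Y : OML ℓ} (f : Lin X Y) → Lin X (Down Y (fun f (OML.𝟙 X)))
  eMap f = (iMap f) † ∘L f

  mMap : {X Y : OML ℓ} (f : Lin X Y) →
         Lin (Down X (adj f (OML.𝟙 Y))) (Down Y (fun f (OML.𝟙 X)))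
  mMap f = eMap f ∘L iMap (f †)

-- Write a = f(1) and b = f*(1). A linear map is monotone and satisfies f(π_b x) ≈ f x, since
-- every f* y lies below b and ⊥-ness to elements below b is invariant under π_b. Every f x lies
-- below a, and π_a fixes ↓ a by orthomodularity; this makes e_f and m_f the corestrictions and
-- gives both factorizations. A map hitting the top element is zero-epi, because g ∘ e = 0 forces
-- e(1) ⊥ g*(1) and hence g = 0; e_f and m_f hit the top element a since a ≤ f(b), and m_f is
-- zero-mono by the same argument applied to f*. Finally ↓ a is the kernel of π_{aᶜ}, and
-- Im f = ↓ aᶜᶜ is the same subobject.
module Submission where

open import Defs
open import Level using (Level)
open import Data.Product using (Σ; _×_; _,_; proj₁; proj₂; swap)

module OMLFacts {ℓ} (X : OML ℓ) where
  open OML X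
  open OMLProps X

  ≈-refl : ∀ {x} → x ≈ x
  ≈-refl = ≤-refl , ≤-refl

  ≈-sym : ∀ {x y} → x ≈ y → y ≈ x
  ≈-sym = swap

  ≈-trans : ∀ {x y z} → x ≈ y → y ≈ z → x ≈ z
  ≈-trans (p , p') (q , q') = p ∙ q , q' ∙ p'

  ≤-from-⊥ : ∀ {p q} → (∀ y → q ⊥ y → p ⊥ y) → p ≤ q
  ≤-from-⊥ {q = q} k = k (q ᶜ) ≤-ᶜᶜ ∙ ᶜᶜ-≤

  𝟙ᶜ≤𝟘 : 𝟙 ᶜ ≤ 𝟘
  𝟙ᶜ≤𝟘 = ∧-glb 𝟙-max ≤-refl ∙ ∧ᶜ-𝟘

  sasaki : Carrier → Carrier → Carrier
  sasaki a x = a ∧ (a ᶜ ∨ x)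

  sasaki-fix : ∀ {a x} → x ≤ a → sasaki a x ≈ x
  sasaki-fix p = omd p , ∧-glb p ∨-ub₂

  ⊥-sasaki : ∀ {a c} x → c ≤ a → x ⊥ c → sasaki a x ⊥ c
  ⊥-sasaki {a} {c} x c≤a p = proj₂ (adjoint (incl X a †) x (c , c≤a)) p ∙ ∧-lb₂

  ⊥-sasaki⁻ : ∀ {a c} x → c ≤ a → sasaki a x ⊥ c → x ⊥ c
  ⊥-sasaki⁻ {a} {c} x c≤a p = proj₁ (adjoint (incl X a †) x (c , c≤a)) (∧-glb ∧-lb₁ p)

open OMLFacts using (sasaki)

fun-mono : ∀ {ℓ} {A B : OML ℓ} (f : Lin A B) {x x'} →
           OML._≤_ A x x' → OML._≤_ B (fun f x) (fun f x')
fun-mono {A = A} {B} f {x} {x'} p = OMLFacts.≤-from-⊥ B λ y q →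
  proj₂ (adjoint f x y) (OML.≤-trans A p (proj₁ (adjoint f x' y) q))

module _ {ℓ} {A B : OML ℓ} (f : Lin A B) where
  private
    module A = OML A
    module B = OML B

  fun-sasaki : ∀ x → fun f (sasaki A (adj f B.𝟙) x) B.≈ fun f x
  fun-sasaki x =
      OMLFacts.≤-from-⊥ B (λ y q → proj₂ (adjoint f _ y)
        (OMLFacts.⊥-sasaki A x (fun-mono (f †) B.𝟙-max) (proj₁ (adjoint f x y) q)))
    , OMLFacts.≤-from-⊥ B (λ y q → proj₂ (adjoint f x y)
        (OMLFacts.⊥-sasaki⁻ A x (fun-mono (f †) B.𝟙-max) (proj₁ (adjoint f _ y) q)))

  fun-𝟙≤fun-adj-𝟙 : fun f A.𝟙 B.≤ fun f (adj f B.𝟙)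
  fun-𝟙≤fun-adj-𝟙 = B.≤-trans (proj₂ (fun-sasaki A.𝟙)) (fun-mono f A.∧-lb₁)

preserves-𝟙⇒zeroEpi : ∀ {ℓ} {A B : OML ℓ} (e : Lin A B) →
                      OML._≤_ B (OML.𝟙 B) (fun e (OML.𝟙 A)) → ZeroEpi e
preserves-𝟙⇒zeroEpi {A = A} {B} e 𝟙≤e𝟙 C g g∘e≃0 u =
  C.≤-trans (proj₂ (adjoint g u C.𝟙) u⊥g*𝟙) (OMLFacts.𝟙ᶜ≤𝟘 C) , C.𝟘-min
  where
    module B = OML B
    module C = OML C
    e𝟙⊥g*𝟙 : fun e (OML.𝟙 A) B.⊥ adj g C.𝟙
    e𝟙⊥g*𝟙 = proj₁ (adjoint g _ C.𝟙) (C.≤-trans (proj₁ (g∘e≃0 (OML.𝟙 A))) C.𝟘-min)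
    u⊥g*𝟙 : u B.⊥ adj g C.𝟙
    u⊥g*𝟙 = B.≤-trans B.𝟙-max (B.≤-trans 𝟙≤e𝟙 e𝟙⊥g*𝟙)

module _ {ℓ} (Y : OML ℓ) where
  open OML Y
  open OMLProps Y

  incl-daggerMono : ∀ a → DaggerMono (incl Y a)
  incl-daggerMono a u = OMLFacts.sasaki-fix Y (proj₂ u)

  corestrict : ∀ {W : OML ℓ} a (h : Lin W Y) → (∀ w → fun h w ≤ a) → Lin W (Down Y a)
  corestrict a h h≤a = record
    { fun = λ w → fun h w , h≤a w
    ; adj = λ u → adj h (proj₁ u)
    ; adjoint = λ w u → (λ p → proj₁ (adjoint h w (proj₁ u)) (p ∙ ∧-lb₂))
                      , (λ p → ∧-glb (h≤a w) (proj₂ (adjoint h w (proj₁ u)) p))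
    }

  incl-daggerKernel : ∀ a → IsDaggerKernel (incl Y a)
  incl-daggerKernel a = (Down Y (a ᶜ) , incl Y (a ᶜ) † , π∘incl≃0 , universal) , incl-daggerMono a
    where
      π∘incl≃0 : incl Y (a ᶜ) † ∘L incl Y a ≃ 0L (Down Y a) (Down Y (a ᶜ))
      π∘incl≃0 u = (∧-mono ≤-refl (∨-lub ≤-refl (proj₂ u ∙ ≤-ᶜᶜ)) ∙ ∧ᶜ-𝟘) , 𝟘-min
      universal : ∀ (W : OML ℓ) (h : Lin W Y) → incl Y (a ᶜ) † ∘L h ≃ 0L W (Down Y (a ᶜ)) →
        Σ (Lin W (Down Y a)) (λ h' → (incl Y a ∘L h' ≃ h) × (∀ h'' → incl Y a ∘L h'' ≃ h → h'' ≃ h'))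
      universal W h π∘h≃0 = corestrict a h h≤a , (λ _ → OMLFacts.≈-refl Y) , (λ _ eq → eq)
        where
          h≤a : ∀ w → fun h w ≤ a
          h≤a w = proj₁ (adjoint (incl Y (a ᶜ) †) (fun h w) (a ᶜ , ≤-refl)) (proj₁ (π∘h≃0 w) ∙ 𝟘-min)
                  ∙ ᶜᶜ-≤

  Down-resp-≈ : ∀ {a a'} → a ≈ a' → Lin (Down Y a) (Down Y a')
  Down-resp-≈ (a≤a' , a'≤a) = record
    { fun = λ u → proj₁ u , (proj₂ u ∙ a≤a')
    ; adj = λ v → proj₁ v , (proj₂ v ∙ a'≤a)
    ; adjoint = λ u v → (λ p → p ∙ ∧-mono a'≤a ≤-refl) , (λ p → p ∙ ∧-mono a≤a' ≤-refl)
    }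

  Down-resp-≈-unitary : ∀ {a a'} (a≈a' : a ≈ a') → Unitary (Down-resp-≈ a≈a')
  Down-resp-≈-unitary _ = (λ _ → OMLFacts.≈-refl Y) , (λ _ → OMLFacts.≈-refl Y)

module _ {ℓ} {X Y : OML ℓ} (f : Lin X Y) where
  private
    module X = OML X
    module Y = OML Y

  eMap-corestricts : ∀ x → proj₁ (fun (eMap f) x) Y.≈ fun f x
  eMap-corestricts x = OMLFacts.sasaki-fix Y (fun-mono f X.𝟙-max)

  eMap-preserves-𝟙 : OML._≤_ (Down Y (fun f X.𝟙)) (OML.𝟙 (Down Y (fun f X.𝟙))) (fun (eMap f) X.𝟙)
  eMap-preserves-𝟙 = Y.∧-glb Y.≤-refl Y.∨-ub₂

  mMap-preserves-𝟙 : OML._≤_ (Down Y (fun f X.𝟙)) (OML.𝟙 (Down Y (fun f X.𝟙)))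
                             (fun (mMap f) (OML.𝟙 (Down X (adj f Y.𝟙))))
  mMap-preserves-𝟙 = Y.∧-glb Y.≤-refl (Y.≤-trans (fun-𝟙≤fun-adj-𝟙 f) Y.∨-ub₂)

proposition14 : ∀ {ℓ : Level} {X Y : OML ℓ} (f : Lin X Y) →
    Σ (Lin (Down Y (fun f (OML.𝟙 X))) (ImObj f)) (λ φ → Unitary φ × (imMor f ∘L φ ≃ iMap f))
    × (∀ x → OML._≈_ Y (proj₁ (fun (eMap f) x)) (fun f x))
    × (∀ u → OML._≈_ Y (proj₁ (fun (mMap f) u)) (fun f (proj₁ u)))
    × (f ≃ iMap f ∘L eMap f)
    × ZeroEpi (eMap f)
    × IsDaggerKernel (iMap f)
    × (f ≃ iMap f ∘L (mMap f ∘L (iMap (f †)) †))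
    × DaggerEpi ((iMap (f †)) †)
    × ZeroEpi (mMap f)
    × ZeroMono (mMap f)
    × DaggerMono (iMap f)
proposition14 {X = X} {Y} f =
    (Down-resp-≈ Y a≈aᶜᶜ , Down-resp-≈-unitary Y a≈aᶜᶜ , λ _ → ≈-refl)
  , eMap-corestricts f
  , (λ u → eMap-corestricts f (proj₁ u))
  , (λ x → ≈-sym (eMap-corestricts f x))
  , preserves-𝟙⇒zeroEpi (eMap f) (eMap-preserves-𝟙 f)
  , incl-daggerKernel Y a
  , (λ x → ≈-trans (≈-sym (fun-sasaki f x)) (≈-sym (eMap-corestricts f (sasaki X b x))))
  , incl-daggerMono X b
  , preserves-𝟙⇒zeroEpi (mMap f) (mMap-preserves-𝟙 f)
  , preserves-𝟙⇒zeroEpi (mMap f †) (mMap-preserves-𝟙 (f †))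
  , incl-daggerMono Y a
  where
    open OMLFacts Y using (≈-refl; ≈-sym; ≈-trans)
    a : OML.Carrier Y
    a = fun f (OML.𝟙 X)
    b : OML.Carrier X
    b = adj f (OML.𝟙 Y)
    a≈aᶜᶜ : OML._≈_ Y a (OML._ᶜ Y (OML._ᶜ Y a))
    a≈aᶜᶜ = OML.≤-ᶜᶜ Y , OML.ᶜᶜ-≤ Y
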